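{- Let $V_2 \subset \mathbb{R}^6$ be the set of $15$ distinct vectors obtained by permuting the coordinates of $(2,2,0,0,0,0)$, and let $V_3 \subset \mathbb{R}^6$ be the set of $15$ distinct vectors obtained by permuting the coordinates of $(2,2,2,2,0,0)$. Let $H$ be the graph with vertex set $V_2 \cup V_3$ in which two vertices are adjacent if and only if their Euclidean distance equals $\sqrt{8}$. Then the chromatic number of $H$ is $8$.
   Context: The chromatic number of a graph is the minimum number of colors in a proper vertex coloring (adjacent vertices receive distinct colors). -}

module Defs where

open import Data.Nat using (ℕ; _+_; _*_; _<_; ∣_-_∣)
open import Data.Fin using (Fin)
open import Data.Vec using (Vec; toList; zipWith; _∷_; [])
open import Data.List using (List)
open import Data.Nat.ListAction using (sum)
open import Data.List.Relation.Binary.Permutation.Propositional using (_↭_)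
open import Data.Product using (Σ; _×_)
open import Data.Sum using (_⊎_)
open import Relation.Binary.PropositionalEquality using (_≡_; _≢_)
open import Relation.Nullary using (¬_)

-- Points of R^6 whose coordinates all lie in ℕ are represented as Vec ℕ 6.
-- All vertices of H have coordinates in {0,2}, so this loses nothing.
Point : Set
Point = Vec ℕ 6

InV2 : Point → Set
InV2 v = toList v ↭ toList (2 ∷ 2 ∷ 0 ∷ 0 ∷ 0 ∷ 0 ∷ [])

InV3 : Point → Set
InV3 v = toList v ↭ toList (2 ∷ 2 ∷ 2 ∷ 2 ∷ 0 ∷ 0 ∷ [])

InH : Point → Set
InH v = InV2 v ⊎ InV3 v

sqDist : Point → Point → ℕ
sqDist u v = sum (toList (zipWith (λ a b → ∣ a - b ∣ * ∣ a - b ∣) u v))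

-- adjacency in H: Euclidean distance = √8, i.e. squared distance = 8
Adj : Point → Point → Set
Adj u v = sqDist u v ≡ 8

ProperColouring : (k : ℕ) → (Point → Fin k) → Set
ProperColouring k c = ∀ u v → InH u → InH v → Adj u v → c u ≢ c v

Colourable : ℕ → Set
Colourable k = Σ (Point → Fin k) (ProperColouring k)

ChromaticNumberIs : ℕ → Set
ChromaticNumberIs χ = Colourable χ × (∀ k → k < χ → ¬ Colourable k)

-- Upper bound: an explicit 8-colouring of the 30 vertices, checked pair by pair.
-- Lower bound: H has independence number at most 4: no five vertices are pairwise
-- non-adjacent (checked by an exhaustive search over increasing 5-tuples).  Each
-- colour class of a proper colouring is independent, so by the pigeonhole
-- principle with capacity 4, a proper k-colouring forces 30 ≤ 4k, hence k ≥ 8.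
module Submission where

open import Defs
open import Data.Bool using (if_then_else_)
open import Data.Empty using (⊥-elim)
open import Data.Fin as F using (Fin; zero; suc) renaming (_≟_ to _≟ᶠ_; _<_ to _<ᶠ_; _<?_ to _<ᶠ?_)
open import Data.Fin.Properties using (all?; any?)
open import Data.List using (List; []; _∷_; length; filter; allFin)
open import Data.List.Properties using () renaming (≡-dec to ≡-decₗ)
open import Data.List.Relation.Binary.Permutation.Propositional using (_↭_; ↭-trans; ↭-sym)
open import Data.List.Relation.Binary.Permutation.Propositional.Properties using (All-resp-↭)
open import Data.List.Relation.Unary.All as All using (All; []; _∷_)
open import Data.List.Relation.Unary.All.Properties using (all-filter)
open import Data.List.Relation.Unary.AllPairs using (AllPairs; []; _∷_)
open import Data.List.Relation.Unary.AllPairs.Properties using (tabulate⁺-<; filter⁺)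
open import Data.Nat using (ℕ; suc; _+_; _*_; _≤_; _<_; z≤n; s≤s; _≟_)
open import Data.Nat.ListAction using (sum)
open import Data.Nat.ListAction.Properties using (sum-↭)
open import Data.Nat.Properties
  using (+-mono-≤; *-monoˡ-≤; ≤-pred; <⇒≱; n≤1+n; module ≤-Reasoning; ≤-decTotalOrder; +-0-commutativeMonoid)
open import Algebra.Properties.CommutativeMonoid.Sum +-0-commutativeMonoid
  using (∑-distrib-+; sum-cong-≗; sum-replicate-zero) renaming (sum to ∑)
open import Data.List.Sort.InsertionSort.Base ≤-decTotalOrder using (sort)
open import Data.List.Sort.InsertionSort.Properties ≤-decTotalOrder using (sort-↭)
open import Data.Product using (∃; _×_; _,_)
open import Data.Sum using (_⊎_; inj₁; inj₂) renaming (map to ⊎-map)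
open import Data.Vec using (Vec; []; _∷_; lookup; toList; map)
open import Data.Vec.Properties using () renaming (≡-dec to ≡-decᵥ)
open import Function using (_∘_)
open import Relation.Binary.PropositionalEquality
  using (_≡_; _≢_; refl; sym; trans; cong; cong₂; subst; module ≡-Reasoning)
open import Relation.Nullary using (¬_; Dec; yes; no; does; map′; ¬?; _×-dec_; _⊎-dec_; _→-dec_)
open import Relation.Nullary.Decidable using (from-yes)

indicator : ∀ {k} → Fin k → Fin k → ℕ
indicator i j = if does (i ≟ᶠ j) then 1 else 0

sum-indicator : ∀ {k} (i : Fin k) → ∑ (indicator i) ≡ 1
sum-indicator {suc k} zero    = cong suc (sum-replicate-zero k)
sum-indicator         (suc i) = sum-indicator i

sum-bounded : ∀ {k a} (f : Fin k → ℕ) → (∀ j → f j ≤ a) → ∑ f ≤ k * a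
sum-bounded {0}     f f≤a = z≤n
sum-bounded {suc k} f f≤a = +-mono-≤ (f≤a zero) (sum-bounded (f ∘ suc) (f≤a ∘ suc))

module Pigeonhole {A : Set} {k : ℕ} (c : A → Fin k) where

  colourClass : Fin k → List A → List A
  colourClass j = filter (λ x → c x ≟ᶠ j)

  classSize : List A → Fin k → ℕ
  classSize xs j = length (colourClass j xs)

  classSize-∷ : ∀ x xs j → classSize (x ∷ xs) j ≡ indicator (c x) j + classSize xs j
  classSize-∷ x xs j with c x ≟ᶠ j
  ... | yes _ = refl
  ... | no  _ = refl

  length≡∑classSize : ∀ xs → length xs ≡ ∑ (classSize xs)
  length≡∑classSize []       = sym (sum-replicate-zero k)
  length≡∑classSize (x ∷ xs) = begin
    1 + length xs                                   ≡⟨ cong₂ _+_ (sym (sum-indicator (c x))) (length≡∑classSize xs) ⟩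
    ∑ (indicator (c x)) + ∑ (classSize xs)          ≡⟨ sym (∑-distrib-+ (indicator (c x)) (classSize xs)) ⟩
    ∑ (λ j → indicator (c x) j + classSize xs j)    ≡⟨ sum-cong-≗ (λ j → sym (classSize-∷ x xs j)) ⟩
    ∑ (classSize (x ∷ xs))                          ∎
    where open ≡-Reasoning

  pigeonhole : ∀ {a} xs → (∀ j → classSize xs j ≤ a) → length xs ≤ k * a
  pigeonhole xs small = subst (_≤ k * _) (sym (length≡∑classSize xs)) (sum-bounded (classSize xs) small)

↭-by-sorting : ∀ xs ys → sort xs ≡ sort ys → xs ↭ ys
↭-by-sorting xs ys eq = ↭-trans (↭-sym (sort-↭ xs)) (subst (_↭ ys) (sym eq) (sort-↭ ys))

∀-vec? : ∀ {k n} {P : Vec (Fin k) n → Set} → (∀ v → Dec (P v)) → Dec (∀ v → P v)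
∀-vec? {n = 0}     P? = map′ (λ { p [] → p }) (λ h → h []) (P? [])
∀-vec? {n = suc n} P? = map′ (λ { h (x ∷ v) → h x v }) (λ h x v → h (x ∷ v))
                             (all? λ x → ∀-vec? λ v → P? (x ∷ v))

base₂ base₃ : Point
base₂ = 2 ∷ 2 ∷ 0 ∷ 0 ∷ 0 ∷ 0 ∷ []
base₃ = 2 ∷ 2 ∷ 2 ∷ 2 ∷ 0 ∷ 0 ∷ []

vertices : Vec Point 30
vertices =
    (2 ∷ 2 ∷ 0 ∷ 0 ∷ 0 ∷ 0 ∷ []) ∷ (2 ∷ 0 ∷ 2 ∷ 0 ∷ 0 ∷ 0 ∷ []) ∷ (2 ∷ 0 ∷ 0 ∷ 2 ∷ 0 ∷ 0 ∷ [])
  ∷ (2 ∷ 0 ∷ 0 ∷ 0 ∷ 2 ∷ 0 ∷ []) ∷ (2 ∷ 0 ∷ 0 ∷ 0 ∷ 0 ∷ 2 ∷ []) ∷ (0 ∷ 2 ∷ 2 ∷ 0 ∷ 0 ∷ 0 ∷ [])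
  ∷ (0 ∷ 2 ∷ 0 ∷ 2 ∷ 0 ∷ 0 ∷ []) ∷ (0 ∷ 2 ∷ 0 ∷ 0 ∷ 2 ∷ 0 ∷ []) ∷ (0 ∷ 2 ∷ 0 ∷ 0 ∷ 0 ∷ 2 ∷ [])
  ∷ (0 ∷ 0 ∷ 2 ∷ 2 ∷ 0 ∷ 0 ∷ []) ∷ (0 ∷ 0 ∷ 2 ∷ 0 ∷ 2 ∷ 0 ∷ []) ∷ (0 ∷ 0 ∷ 2 ∷ 0 ∷ 0 ∷ 2 ∷ [])
  ∷ (0 ∷ 0 ∷ 0 ∷ 2 ∷ 2 ∷ 0 ∷ []) ∷ (0 ∷ 0 ∷ 0 ∷ 2 ∷ 0 ∷ 2 ∷ []) ∷ (0 ∷ 0 ∷ 0 ∷ 0 ∷ 2 ∷ 2 ∷ [])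
  ∷ (0 ∷ 0 ∷ 2 ∷ 2 ∷ 2 ∷ 2 ∷ []) ∷ (0 ∷ 2 ∷ 0 ∷ 2 ∷ 2 ∷ 2 ∷ []) ∷ (0 ∷ 2 ∷ 2 ∷ 0 ∷ 2 ∷ 2 ∷ [])
  ∷ (0 ∷ 2 ∷ 2 ∷ 2 ∷ 0 ∷ 2 ∷ []) ∷ (0 ∷ 2 ∷ 2 ∷ 2 ∷ 2 ∷ 0 ∷ []) ∷ (2 ∷ 0 ∷ 0 ∷ 2 ∷ 2 ∷ 2 ∷ [])
  ∷ (2 ∷ 0 ∷ 2 ∷ 0 ∷ 2 ∷ 2 ∷ []) ∷ (2 ∷ 0 ∷ 2 ∷ 2 ∷ 0 ∷ 2 ∷ []) ∷ (2 ∷ 0 ∷ 2 ∷ 2 ∷ 2 ∷ 0 ∷ [])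
  ∷ (2 ∷ 2 ∷ 0 ∷ 0 ∷ 2 ∷ 2 ∷ []) ∷ (2 ∷ 2 ∷ 0 ∷ 2 ∷ 0 ∷ 2 ∷ []) ∷ (2 ∷ 2 ∷ 0 ∷ 2 ∷ 2 ∷ 0 ∷ [])
  ∷ (2 ∷ 2 ∷ 2 ∷ 0 ∷ 0 ∷ 2 ∷ []) ∷ (2 ∷ 2 ∷ 2 ∷ 0 ∷ 2 ∷ 0 ∷ []) ∷ (2 ∷ 2 ∷ 2 ∷ 2 ∷ 0 ∷ 0 ∷ [])
  ∷ []

vertex : Fin 30 → Point
vertex = lookup vertices

-- Every listed point is a vertex of H: its sorted coordinates are those of base₂ or base₃.
vertex-inH : ∀ i → InH (vertex i)
vertex-inH i = ⊎-map (↭-by-sorting _ _) (↭-by-sorting _ _) (sortsLikeBase i)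
  where
  sortsLike? : ∀ u b → Dec (sort (toList u) ≡ sort (toList b))
  sortsLike? u b = ≡-decₗ _≟_ (sort (toList u)) (sort (toList b))

  sortsLikeBase : ∀ i → sort (toList (vertex i)) ≡ sort (toList base₂)
                      ⊎ sort (toList (vertex i)) ≡ sort (toList base₃)
  sortsLikeBase = from-yes (all? λ i → sortsLike? (vertex i) base₂ ⊎-dec sortsLike? (vertex i) base₃)

Bit : ℕ → Set
Bit a = a ≡ 0 ⊎ a ≡ 2

bit : Fin 2 → ℕ
bit zero       = 0
bit (suc zero) = 2

fromBits : ∀ {n} (u : Vec ℕ n) → All Bit (toList u) → ∃ λ bs → u ≡ map bit bs
fromBits []      []                = [] , refl
fromBits (_ ∷ u) (inj₁ refl ∷ u∈) with fromBits u u∈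
... | bs , eq = zero ∷ bs , cong (0 ∷_) eq
fromBits (_ ∷ u) (inj₂ refl ∷ u∈) with fromBits u u∈
... | bs , eq = suc zero ∷ bs , cong (2 ∷_) eq

inH-shape : ∀ u → InH u → All Bit (toList u) × (sum (toList u) ≡ 4 ⊎ sum (toList u) ≡ 8)
inH-shape u (inj₁ u↭base₂) = All-resp-↭ (↭-sym u↭base₂) bits₂ , inj₁ (sum-↭ u↭base₂)
  where
  bits₂ : All Bit (toList base₂)
  bits₂ = inj₂ refl ∷ inj₂ refl ∷ inj₁ refl ∷ inj₁ refl ∷ inj₁ refl ∷ inj₁ refl ∷ []
inH-shape u (inj₂ u↭base₃) = All-resp-↭ (↭-sym u↭base₃) bits₃ , inj₂ (sum-↭ u↭base₃)
  where
  bits₃ : All Bit (toList base₃)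
  bits₃ = inj₂ refl ∷ inj₂ refl ∷ inj₂ refl ∷ inj₂ refl ∷ inj₁ refl ∷ inj₁ refl ∷ []

cube-listed : ∀ bs → let u = map bit bs in
              sum (toList u) ≡ 4 ⊎ sum (toList u) ≡ 8 → ∃ λ i → u ≡ vertex i
cube-listed = from-yes (∀-vec? λ bs → let u = map bit bs in
  ((sum (toList u) ≟ 4) ⊎-dec (sum (toList u) ≟ 8)) →-dec any? λ i → ≡-decᵥ _≟_ u (vertex i))

inH⇒vertex : ∀ u → InH u → ∃ λ i → u ≡ vertex i
inH⇒vertex u u∈H with inH-shape u u∈H
... | bits , sum4or8 with fromBits u bits
...   | bs , refl = cube-listed bs sum4or8

palette : Vec (Fin 8) 30
palette = F.# 0 ∷ F.# 1 ∷ F.# 2 ∷ F.# 3 ∷ F.# 4 ∷ F.# 2 ∷ F.# 1 ∷ F.# 4 ∷ F.# 3 ∷ F.# 0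
        ∷ F.# 5 ∷ F.# 6 ∷ F.# 6 ∷ F.# 5 ∷ F.# 0 ∷ F.# 1 ∷ F.# 2 ∷ F.# 7 ∷ F.# 4 ∷ F.# 3
        ∷ F.# 7 ∷ F.# 2 ∷ F.# 3 ∷ F.# 4 ∷ F.# 1 ∷ F.# 6 ∷ F.# 5 ∷ F.# 5 ∷ F.# 6 ∷ F.# 7 ∷ []

-- A point receives the colour of the listed vertex it equals (points off H get colour 0).
colour : Point → Fin 8
colour u with any? (λ i → ≡-decᵥ _≟_ u (vertex i))
... | yes (i , _) = lookup palette i
... | no  _       = zero

colour-proper-on-vertices : ∀ i j → Adj (vertex i) (vertex j) → colour (vertex i) ≢ colour (vertex j)
colour-proper-on-vertices = from-yes (all? λ i → all? λ j →
  (sqDist (vertex i) (vertex j) ≟ 8) →-dec ¬? (colour (vertex i) ≟ᶠ colour (vertex j)))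

-- Every point of H is listed, so the colouring is proper on all of H.
eight-colourable : Colourable 8
eight-colourable = colour , proper
  where
  proper : ProperColouring 8 colour
  proper u v u∈H v∈H with inH⇒vertex u u∈H | inH⇒vertex v v∈H
  ... | i , refl | j , refl = colour-proper-on-vertices i j

NonAdjacent : Fin 30 → Fin 30 → Set
NonAdjacent i j = i <ᶠ j × ¬ Adj (vertex i) (vertex j)

nonAdjacent? : ∀ i j → Dec (NonAdjacent i j)
nonAdjacent? i j = (i <ᶠ? j) ×-dec ¬? (sqDist (vertex i) (vertex j) ≟ 8)

no-independent-5 : ∀ a b → NonAdjacent a b →
                   ∀ c → NonAdjacent a c → NonAdjacent b c →
                   ∀ d → NonAdjacent a d → NonAdjacent b d → NonAdjacent c d →
                   ∀ e → NonAdjacent a e → NonAdjacent b e → NonAdjacent c e → ¬ NonAdjacent d e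
no-independent-5 = from-yes
  (all? λ a → all? λ b → nonAdjacent? a b →-dec
   all? λ c → nonAdjacent? a c →-dec (nonAdjacent? b c →-dec
   all? λ d → nonAdjacent? a d →-dec (nonAdjacent? b d →-dec (nonAdjacent? c d →-dec
   all? λ e → nonAdjacent? a e →-dec (nonAdjacent? b e →-dec (nonAdjacent? c e →-dec
              ¬? (nonAdjacent? d e)))))))

independent≤4 : ∀ xs → AllPairs NonAdjacent xs → length xs ≤ 4
independent≤4 []                    _ = z≤n
independent≤4 (_ ∷ [])              _ = s≤s z≤n
independent≤4 (_ ∷ _ ∷ [])          _ = s≤s (s≤s z≤n)
independent≤4 (_ ∷ _ ∷ _ ∷ [])      _ = s≤s (s≤s (s≤s z≤n))
independent≤4 (_ ∷ _ ∷ _ ∷ _ ∷ [])  _ = s≤s (s≤s (s≤s (s≤s z≤n)))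
independent≤4 (a ∷ b ∷ c ∷ d ∷ e ∷ _)
  ((ab ∷ ac ∷ ad ∷ ae ∷ _) ∷ (bc ∷ bd ∷ be ∷ _) ∷ (cd ∷ ce ∷ _) ∷ (de ∷ _) ∷ _) =
  ⊥-elim (no-independent-5 a b ab c ac bc d ad bd cd e ae be ce de)

allPairs-restrict : ∀ {A : Set} {P : A → Set} {R : A → A → Set} {xs} →
                    All P xs → AllPairs (λ x y → P x → P y → R x y) xs → AllPairs R xs
allPairs-restrict []         []         = []
allPairs-restrict (px ∷ pxs) (rx ∷ rxs) =
  All.zipWith (λ (py , r) → r px py) (pxs , rx) ∷ allPairs-restrict pxs rxs

-- A proper k-colouring of H needs 30 ≤ 4k: each colour class of the listed vertices is independent.
colourable⇒30≤k*4 : ∀ {k} → Colourable k → 30 ≤ k * 4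
colourable⇒30≤k*4 (c , proper) = pigeonhole (allFin 30) classSmall
  where
  open Pigeonhole (c ∘ vertex)

  sameColour⇒nonAdjacent : ∀ j {x y} → x <ᶠ y → c (vertex x) ≡ j → c (vertex y) ≡ j → NonAdjacent x y
  sameColour⇒nonAdjacent j {x} {y} x<y cx cy =
    x<y , λ adj → proper (vertex x) (vertex y) (vertex-inH x) (vertex-inH y) adj (trans cx (sym cy))

  -- A colour class, taken from the increasing list of all indices, is an increasing independent list.
  classSmall : ∀ j → classSize (allFin 30) j ≤ 4
  classSmall j = independent≤4 (colourClass j (allFin 30))
    (allPairs-restrict (all-filter hasColour? (allFin 30))
                       (filter⁺ hasColour? (tabulate⁺-< (sameColour⇒nonAdjacent j))))
    where
    hasColour? : ∀ x → Dec (c (vertex x) ≡ j)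
    hasColour? x = c (vertex x) ≟ᶠ j

mainTheorem1 : ChromaticNumberIs 8
mainTheorem1 = eight-colourable , fewerColoursFail
  where
  fewerColoursFail : ∀ k → k < 8 → ¬ Colourable k
  fewerColoursFail k k<8 col = <⇒≱ 28<30 (begin
    30     ≤⟨ colourable⇒30≤k*4 col ⟩
    k * 4  ≤⟨ *-monoˡ-≤ 4 (≤-pred k<8) ⟩
    28     ∎)
    where
    open ≤-Reasoning
    28<30 : 28 < 30
    28<30 = n≤1+n 29
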